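{- Let $n=4m>1$ and let $H$ be an $n\times n$ circulant Hadamard matrix with defining row $H_1$. Let $\alpha_1$, $\alpha_2$, $\alpha_{\geq 3}$ denote the numbers of $1$-alternating, $2$-alternating and $\geq 3$-alternating sequences of $H_1$, respectively, and let $\alpha_{2,\geq 3}$ denote the number of pairs of cyclically consecutive blocks $B,B'$ of $H_1$ such that one of them has size $2$ and the other has size at least $3$. Then $$\alpha_1+\alpha_{2,\geq 3}=\alpha_2+\alpha_{\geq 3}.$$
   Context: A Hadamard matrix is an $n\times n$ matrix with entries in $\{+1,-1\}$ whose rows are mutually orthogonal. It is circulant if, writing its first row (the defining row) as $H_1=(h_1,\ldots,h_n)$, its $i$-th row is $H_i=(h_{1-i+1},\ldots,h_{n-i+1})$ with subscripts taken modulo $n$. Regard $H_1$ as a circular (cyclic) sequence of $+1$'s and $-1$'s. A block is a maximal set of cyclically consecutive entries of $H_1$ that are all equal; its size is its number of entries. Thus $H_1$ decomposes into a cyclic sequence of blocks of alternating sign. For a positive integer $k$, a $k$-alternating sequence is a maximal run of cyclically consecutive blocks all of size exactly $k$, and a $\geq k$-alternating sequence is a maximal run of cyclically consecutive blocks all of size at least $k$. -}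

module Defs where

open import Data.Nat as ℕ using (ℕ; zero; suc; _≡ᵇ_; _≤ᵇ_)
open import Data.Nat.DivMod using (_%_; m%n<n)
open import Data.Integer as ℤ using (ℤ; _≟_)
open import Data.Fin using (Fin; toℕ; fromℕ<)
open import Data.List using (List; []; _∷_; tabulate; foldr; map; zip; drop; take; _++_)
open import Data.Product using (_×_; _,_; proj₁; proj₂)
open import Data.Sum using (_⊎_)
open import Data.Bool using (Bool; true; false; if_then_else_; _∧_; _∨_; not)
open import Relation.Nullary using (¬_)
open import Relation.Nullary.Decidable using (⌊_⌋)
open import Relation.Binary.PropositionalEquality using (_≡_)

Matrix : ℕ → Set
Matrix n = Fin n → Fin n → ℤ

sumℤ : List ℤ → ℤ
sumℤ = foldr ℤ._+_ (ℤ.+ 0)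

rowDot : ∀ {n} → Matrix n → Fin n → Fin n → ℤ
rowDot {n} M i j = sumℤ (map (λ k → M i k ℤ.* M j k) (Data.List.allFin n))

IsHadamard : ∀ {n} → Matrix n → Set
IsHadamard {n} M =
  (∀ i j → M i j ≡ ℤ.+ 1 ⊎ M i j ≡ ℤ.- (ℤ.+ 1)) ×
  (∀ i j → ¬ (i ≡ j) → rowDot M i j ≡ ℤ.+ 0)

-- circulant matrix with defining row h:  (circ h) i j = h (j - i mod n)
-- (0-indexed version of H_i = (h_{1-i+1}, …, h_{n-i+1}))
circ : ∀ {n} → (Fin n → ℤ) → Matrix n
circ {zero} h ()
circ {suc n} h i j = h (fromℕ< (m%n<n ((suc n ℕ.+ toℕ j) ℕ.∸ toℕ i) (suc n)))

rle : List ℤ → List (ℤ × ℕ)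
rle [] = []
rle (x ∷ xs) with rle xs
... | [] = (x , 1) ∷ []
... | (y , k) ∷ rest = if ⌊ x ≟ y ⌋ then (y , suc k) ∷ rest
                                      else (x , 1) ∷ (y , k) ∷ rest

-- helper: walk to the last run; merge it with the first run (value v,
-- length k) if they carry the same value (cyclic wrap-around).
-- Output is a cyclic rotation of the cyclic block-size sequence.
cycGo : ℤ → ℕ → List (ℤ × ℕ) → List ℕ
cycGo v k [] = k ∷ []
cycGo v k ((w , j) ∷ []) = if ⌊ w ≟ v ⌋ then (k ℕ.+ j) ∷ [] else j ∷ k ∷ []
cycGo v k ((w , j) ∷ q ∷ qs) = j ∷ cycGo v k (q ∷ qs)

cycSizes : List (ℤ × ℕ) → List ℕ
cycSizes [] = []
cycSizes ((v , k) ∷ []) = k ∷ []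
cycSizes ((v , k) ∷ q ∷ qs) = cycGo v k (q ∷ qs)

rowList : ∀ {n} → (Fin n → ℤ) → List ℤ
rowList h = tabulate h

blockSizes : ∀ {n} → (Fin n → ℤ) → List ℕ
blockSizes h = cycSizes (rle (rowList h))

rotate1 : List ℕ → List ℕ
rotate1 L = drop 1 L ++ take 1 L

consecPairs : List ℕ → List (ℕ × ℕ)
consecPairs L = zip L (rotate1 L)

count : {A : Set} → (A → Bool) → List A → ℕ
count p = foldr (λ a r → if p a then suc r else r) 0

allB : (ℕ → Bool) → List ℕ → Bool
allB P = foldr (λ a r → P a ∧ r) true

nonEmpty : List ℕ → Bool
nonEmpty [] = false
nonEmpty (_ ∷ _) = true

-- number of maximal cyclic runs of consecutive blocks whose sizes satisfy P:
-- number of blocks satisfying P whose predecessor does not, plus one if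
-- every block satisfies P (the whole cycle is then a single run).
numRuns : (ℕ → Bool) → List ℕ → ℕ
numRuns P L =
  count (λ pr → not (P (proj₁ pr)) ∧ P (proj₂ pr)) (consecPairs L)
  ℕ.+ (if nonEmpty L ∧ allB P L then 1 else 0)

alpha : ℕ → ∀ {n} → (Fin n → ℤ) → ℕ
alpha k h = numRuns (λ s → s ≡ᵇ k) (blockSizes h)

alphaGE : ℕ → ∀ {n} → (Fin n → ℤ) → ℕ
alphaGE k h = numRuns (λ s → k ≤ᵇ s) (blockSizes h)

alpha2GE3 : ∀ {n} → (Fin n → ℤ) → ℕ
alpha2GE3 h = count (λ pr → ((proj₁ pr ≡ᵇ 2) ∧ (3 ≤ᵇ proj₂ pr))
                          ∨ ((3 ≤ᵇ proj₁ pr) ∧ (proj₂ pr ≡ᵇ 2)))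
                    (consecPairs (blockSizes h))

{-# OPTIONS --safe #-}
-- Read the defining row as an n-periodic ±1 sequence x. Orthogonality of the first row to its
-- cyclic shift by one says Σₜ xₜ xₜ₊₁ = 0, so exactly n/2 cyclically adjacent pairs change sign;
-- these are the block boundaries, hence there are n/2 blocks of total size n. Mean block size 2
-- rules out that all blocks have size 1 or all have size ≥ 3, and if all had size 2 then
-- xₜ₊₂ = -xₜ (consistently around the cycle since 4 ∣ n), contradicting orthogonality to the
-- shift by two. So no class of sizes fills the whole cycle, every maximal run of a class starts
-- at a consecutive pair (a, b) with a outside and b inside the class, and one checks
--   [a ≠ 1 = b] + [a, b are 2 and ≥ 3 in some order] + [a = 1]
--     = [a ≠ 2 = b] + [a < 3 ≤ b] + [b = 1].
-- Summed around the cycle the terms [a = 1] and [b = 1] cancel, leaving α₁ + α₂,≥₃ = α₂ + α≥₃.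
module Submission where

open import Defs
open import Data.Nat using (ℕ; zero; suc; _+_; _*_; _<_; _≤_; z≤n; s≤s; _∸_; _%_; _/_; _≡ᵇ_; _≤ᵇ_)
open import Data.Nat.Properties
  using (+-comm; +-assoc; +-identityʳ; +-suc; +-cancelˡ-≡; +-cancelʳ-≡; +-mono-≤; *-suc;
         *-distribˡ-+; *-monoˡ-<; m≤m+n; m<m+n; m+[n∸m]≡n; ≤-trans; ≤-refl; <-irrefl;
         <⇒≢; <⇒≱; <⇒≤; ≡ᵇ⇒≡; ≤ᵇ⇒≤; suc-injective; +-commutativeSemigroup)
open import Data.Nat.Base using (NonZero; >-nonZero)
open import Data.Nat.DivMod using (_mod_; m%n<n; m%n%n≡m%n; [m+n]%n≡m%n; m<n⇒m%n≡m; m≡m%n+[m/n]*n)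
open import Data.Nat.Divisibility using (_∣_; divides; ∣⇒≤; m∣m*n)
open import Data.Nat.ListAction using (sum)
open import Data.Nat.ListAction.Properties using (sum-++)
open import Data.Integer using (ℤ; +_; -_; -[1+_]; 0ℤ; 1ℤ; -1ℤ)
  renaming (_+_ to _+ℤ_; _*_ to _*ℤ_; _≟_ to _≟ℤ_)
open import Data.Integer.Properties using (neg-involutive; +-injective)
  renaming (+-assoc to +ℤ-assoc; +-identityˡ to +ℤ-identityˡ)
open import Data.Integer.Tactic.RingSolver using (solve-∀)
open import Data.Fin using (Fin; zero; suc; toℕ; fromℕ<)
open import Data.Fin.Properties using (toℕ<n; fromℕ<-cong; fromℕ<-toℕ; toℕ-fromℕ<)
open import Data.Bool using (Bool; true; false; T; not; _∧_; _∨_; if_then_else_)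
open import Data.Bool.Properties using (∧-zeroʳ)
open import Data.Unit using (tt)
open import Data.Empty using (⊥-elim)
open import Data.Maybe using (just)
open import Data.Maybe.Properties using (just-injective)
open import Data.List
  using (List; []; _∷_; _++_; _∷ʳ_; length; map; zip; replicate; tabulate; applyUpTo; last)
open import Data.List.Properties
  using (length-++; length-replicate; map-++; map-tabulate; tabulate-cong; applyUpTo-∷ʳ;
         length-applyUpTo; ∷-injective)
open import Data.List.Relation.Unary.All using (All; []; _∷_)
open import Data.List.Relation.Unary.All.Properties using (++⁺; applyUpTo⁺₂)
open import Data.Product using (_×_; _,_; proj₁; proj₂; ∃; ∃₂)
open import Data.Sum using (_⊎_; inj₁; inj₂)
open import Function using (_∘_; id)
open import Relation.Nullary using (¬_; Dec; yes; no)
open import Relation.Nullary.Decidable using (⌊_⌋)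
open import Relation.Binary.PropositionalEquality
  using (_≡_; _≢_; refl; sym; trans; cong; cong₂; subst; module ≡-Reasoning)
open import Algebra.Properties.CommutativeSemigroup +-commutativeSemigroup using (interchange; x∙yz≈y∙xz)

open ≡-Reasoning

indicator : Bool → ℕ
indicator true  = 1
indicator false = 0

count-∷ : ∀ {A : Set} (p : A → Bool) x xs → count p (x ∷ xs) ≡ indicator (p x) + count p xs
count-∷ p x xs with p x
... | true  = refl
... | false = refl

count-+ : ∀ {A : Set} (p q : A → Bool) xs →
          count p xs + count q xs ≡ sum (map (λ a → indicator (p a) + indicator (q a)) xs)
count-+ p q []       = refl
count-+ p q (x ∷ xs) = begin
  count p (x ∷ xs) + count q (x ∷ xs)
    ≡⟨ cong₂ _+_ (count-∷ p x xs) (count-∷ q x xs) ⟩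
  (indicator (p x) + count p xs) + (indicator (q x) + count q xs)
    ≡⟨ interchange (indicator (p x)) (count p xs) (indicator (q x)) (count q xs) ⟩
  (indicator (p x) + indicator (q x)) + (count p xs + count q xs)
    ≡⟨ cong (_+_ (indicator (p x) + indicator (q x))) (count-+ p q xs) ⟩
  sum (map (λ a → indicator (p a) + indicator (q a)) (x ∷ xs)) ∎

length-rotate1 : ∀ xs → length (rotate1 xs) ≡ length xs
length-rotate1 []       = refl
length-rotate1 (x ∷ xs) = trans (length-++ xs) (+-comm (length xs) 1)

All-rotate1 : ∀ {P : ℕ → Set} {xs} → All P xs → All P (rotate1 xs)
All-rotate1 []         = []
All-rotate1 (px ∷ pxs) = ++⁺ pxs (px ∷ [])

sum-map-rotate1 : ∀ (φ : ℕ → ℕ) xs → sum (map φ (rotate1 xs)) ≡ sum (map φ xs)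
sum-map-rotate1 φ []       = refl
sum-map-rotate1 φ (x ∷ xs) = begin
  sum (map φ (xs ∷ʳ x))       ≡⟨ cong sum (map-++ φ xs (x ∷ [])) ⟩
  sum (map φ xs ∷ʳ φ x)       ≡⟨ sum-++ (map φ xs) (φ x ∷ []) ⟩
  sum (map φ xs) + (φ x + 0)  ≡⟨ +-comm (sum (map φ xs)) (φ x + 0) ⟩
  (φ x + 0) + sum (map φ xs)  ≡⟨ cong (_+ sum (map φ xs)) (+-identityʳ (φ x)) ⟩
  φ x + sum (map φ xs)        ∎

module CyclicBalance {P : ℕ → Set} (u v : ℕ × ℕ → ℕ) (φ : ℕ → ℕ)
                     (balance : ∀ {a b} → P a → P b → u (a , b) + φ a ≡ v (a , b) + φ b) where

  zip-balance : ∀ {as bs} → length as ≡ length bs → All P as → All P bs →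
                sum (map u (zip as bs)) + sum (map φ as) ≡ sum (map v (zip as bs)) + sum (map φ bs)
  zip-balance {[]}     {[]}     _  []         []         = refl
  zip-balance {a ∷ as} {b ∷ bs} eq (pa ∷ pas) (pb ∷ pbs) = begin
    (u (a , b) + U) + (φ a + sum (map φ as))  ≡⟨ interchange (u (a , b)) U (φ a) _ ⟩
    (u (a , b) + φ a) + (U + sum (map φ as))
      ≡⟨ cong₂ _+_ (balance pa pb) (zip-balance (suc-injective eq) pas pbs) ⟩
    (v (a , b) + φ b) + (V + sum (map φ bs))  ≡⟨ interchange (v (a , b)) (φ b) V _ ⟩
    (v (a , b) + V) + (φ b + sum (map φ bs))  ∎
    where
    U = sum (map u (zip as bs))
    V = sum (map v (zip as bs))

  cyclic-balance : ∀ {as} → All P as → sum (map u (consecPairs as)) ≡ sum (map v (consecPairs as))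
  cyclic-balance {as} pas = +-cancelʳ-≡ (sum (map φ as)) _ _ (begin
    sum (map u (consecPairs as)) + sum (map φ as)
      ≡⟨ zip-balance (sym (length-rotate1 as)) pas (All-rotate1 pas) ⟩
    sum (map v (consecPairs as)) + sum (map φ (rotate1 as))
      ≡⟨ cong (_+_ (sum (map v (consecPairs as)))) (sum-map-rotate1 φ as) ⟩
    sum (map v (consecPairs as)) + sum (map φ as) ∎)

open CyclicBalance using (cyclic-balance)

isOne isTwo atLeastThree : ℕ → Bool
isOne s        = s ≡ᵇ 1
isTwo s        = s ≡ᵇ 2
atLeastThree s = 3 ≤ᵇ s

runStart : (ℕ → Bool) → ℕ × ℕ → Bool
runStart P pr = not (P (proj₁ pr)) ∧ P (proj₂ pr)

twoNextToThree : ℕ × ℕ → Bool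
twoNextToThree pr = ((proj₁ pr ≡ᵇ 2) ∧ (3 ≤ᵇ proj₂ pr)) ∨ ((3 ≤ᵇ proj₁ pr) ∧ (proj₂ pr ≡ᵇ 2))

run-balance : ∀ {a b} → 1 ≤ a → 1 ≤ b →
  (indicator (runStart isOne (a , b)) + indicator (twoNextToThree (a , b))) + indicator (isOne a)
  ≡ (indicator (runStart isTwo (a , b)) + indicator (runStart atLeastThree (a , b))) + indicator (isOne b)
run-balance {1}                 {1}                 _ _ = refl
run-balance {1}                 {2}                 _ _ = refl
run-balance {1}                 {suc (suc (suc _))} _ _ = refl
run-balance {2}                 {1}                 _ _ = refl
run-balance {2}                 {2}                 _ _ = refl
run-balance {2}                 {suc (suc (suc _))} _ _ = refl
run-balance {suc (suc (suc _))} {1}                 _ _ = refl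
run-balance {suc (suc (suc _))} {2}                 _ _ = refl
run-balance {suc (suc (suc _))} {suc (suc (suc _))} _ _ = refl

¬All⇒allB≡false : ∀ {P : ℕ → Bool} {Q : ℕ → Set} → (∀ {s} → T (P s) → Q s) →
                  ∀ L → ¬ All Q L → allB P L ≡ false
¬All⇒allB≡false sound []      ¬all = ⊥-elim (¬all [])
¬All⇒allB≡false {P} sound (s ∷ L) ¬all with P s in Ps
... | false = refl
... | true  = ¬All⇒allB≡false sound L (λ all → ¬all (sound (subst T (sym Ps) tt) ∷ all))

numRuns-notAll : ∀ P L → allB P L ≡ false → numRuns P L ≡ count (runStart P) (consecPairs L)
numRuns-notAll P L notAll rewrite notAll | ∧-zeroʳ (nonEmpty L) = +-identityʳ _

runIdentity : ∀ L → All (1 ≤_) L → ¬ All (_≡ 1) L → ¬ All (_≡ 2) L → ¬ All (3 ≤_) L →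
  numRuns isOne L + count twoNextToThree (consecPairs L) ≡ numRuns isTwo L + numRuns atLeastThree L
runIdentity L pos ¬ones ¬twos ¬large = begin
  numRuns isOne L + count twoNextToThree ps
    ≡⟨ cong (_+ count twoNextToThree ps) (numRuns-notAll isOne L (¬All⇒allB≡false (≡ᵇ⇒≡ _ 1) L ¬ones)) ⟩
  count (runStart isOne) ps + count twoNextToThree ps
    ≡⟨ count-+ (runStart isOne) twoNextToThree ps ⟩
  sum (map u ps)
    ≡⟨ cyclic-balance u v (indicator ∘ isOne) run-balance pos ⟩
  sum (map v ps)
    ≡⟨ count-+ (runStart isTwo) (runStart atLeastThree) ps ⟨
  count (runStart isTwo) ps + count (runStart atLeastThree) ps
    ≡⟨ cong₂ _+_ (numRuns-notAll isTwo L (¬All⇒allB≡false (≡ᵇ⇒≡ _ 2) L ¬twos))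
                 (numRuns-notAll atLeastThree L (¬All⇒allB≡false (≤ᵇ⇒≤ 3 _) L ¬large)) ⟨
  numRuns isTwo L + numRuns atLeastThree L ∎
  where
  ps = consecPairs L
  u v : ℕ × ℕ → ℕ
  u pr = indicator (runStart isOne pr) + indicator (twoNextToThree pr)
  v pr = indicator (runStart isTwo pr) + indicator (runStart atLeastThree pr)

sum-All≡1 : ∀ {L} → All (_≡ 1) L → sum L ≡ length L
sum-All≡1 []            = refl
sum-All≡1 (refl ∷ ones) = cong suc (sum-All≡1 ones)

sum-All≥3 : ∀ {L} → All (3 ≤_) L → 3 * length L ≤ sum L
sum-All≥3 []                     = z≤n
sum-All≥3 {a ∷ L} (3≤a ∷ large) =
  subst (_≤ a + sum L) (sym (*-suc 3 (length L))) (+-mono-≤ 3≤a (sum-All≥3 large))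

meanTwo⇒¬All≡1 : ∀ {L} → 0 < length L → sum L ≡ 2 * length L → ¬ All (_≡ 1) L
meanTwo⇒¬All≡1 {L} 0<l mean ones =
  <-irrefl (trans (sym (sum-All≡1 ones)) mean)
           (m<m+n (length L) (subst (0 <_) (sym (+-identityʳ (length L))) 0<l))

meanTwo⇒¬All≥3 : ∀ {L} → 0 < length L → sum L ≡ 2 * length L → ¬ All (3 ≤_) L
meanTwo⇒¬All≥3 {L} 0<l mean large =
  <⇒≱ (*-monoˡ-< (length L) {{>-nonZero 0<l}} (≤-refl {3}))
      (subst (3 * length L ≤_) mean (sum-All≥3 large))

IsUnit : ℤ → Set
IsUnit z = z ≡ 1ℤ ⊎ z ≡ -1ℤ

neg-unit : ∀ {v} → IsUnit v → IsUnit (- v)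
neg-unit (inj₁ refl) = inj₂ refl
neg-unit (inj₂ refl) = inj₁ refl

unit-dichotomy : ∀ {u v} → IsUnit u → IsUnit v → v ≡ u ⊎ v ≡ - u
unit-dichotomy (inj₁ refl) (inj₁ refl) = inj₁ refl
unit-dichotomy (inj₁ refl) (inj₂ refl) = inj₂ refl
unit-dichotomy (inj₂ refl) (inj₁ refl) = inj₂ refl
unit-dichotomy (inj₂ refl) (inj₂ refl) = inj₁ refl

unit-≢-neg : ∀ {v} → IsUnit v → v ≢ - v
unit-≢-neg (inj₁ refl) ()
unit-≢-neg (inj₂ refl) ()

unit-square : ∀ {v} → IsUnit v → v *ℤ v ≡ 1ℤ
unit-square (inj₁ refl) = refl
unit-square (inj₂ refl) = refl

neg-unit-* : ∀ {v} → IsUnit v → - v *ℤ v ≡ -1ℤ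
neg-unit-* (inj₁ refl) = refl
neg-unit-* (inj₂ refl) = refl

unit-*-neg : ∀ {v} → IsUnit v → v *ℤ - v ≡ -1ℤ
unit-*-neg (inj₁ refl) = refl
unit-*-neg (inj₂ refl) = refl

signedRuns : ℤ → List ℕ → List (ℤ × ℕ)
signedRuns v []       = []
signedRuns v (k ∷ ks) = (v , k) ∷ signedRuns (- v) ks

expandRuns : ℤ → List ℕ → List ℤ
expandRuns v []       = []
expandRuns v (k ∷ ks) = replicate k v ++ expandRuns (- v) ks

lastRunSign : ℤ → List ℕ → ℤ
lastRunSign v []       = v
lastRunSign v (_ ∷ ks) = lastRunSign (- v) ks

lastRunSign-± : ∀ v ks → lastRunSign v ks ≡ v ⊎ lastRunSign v ks ≡ - v
lastRunSign-± v []       = inj₁ refl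
lastRunSign-± v (_ ∷ ks) with lastRunSign-± (- v) ks
... | inj₁ e = inj₂ e
... | inj₂ e = inj₁ (trans e (neg-involutive v))

rle-∷-same : ∀ x xs {k rs} → rle xs ≡ (x , k) ∷ rs → rle (x ∷ xs) ≡ (x , suc k) ∷ rs
rle-∷-same x xs eq rewrite eq with x ≟ℤ x
... | yes _   = refl
... | no  x≢x = ⊥-elim (x≢x refl)

rle-∷-differs : ∀ {x y} xs {k rs} → x ≢ y → rle xs ≡ (y , k) ∷ rs → rle (x ∷ xs) ≡ (x , 1) ∷ (y , k) ∷ rs
rle-∷-differs {x} {y} xs x≢y eq rewrite eq with x ≟ℤ y
... | yes x≡y = ⊥-elim (x≢y x≡y)
... | no  _   = refl

rle-expandRuns : ∀ {v} → IsUnit v → ∀ ks → All (1 ≤_) ks → rle (expandRuns v ks) ≡ signedRuns v ks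
rle-expandRuns u      []                  []              = refl
rle-expandRuns u      (0 ∷ _)             (() ∷ _)
rle-expandRuns u      (1 ∷ [])            _               = refl
rle-expandRuns u      (1 ∷ 0 ∷ _)         (_ ∷ () ∷ _)
rle-expandRuns {v} u  (1 ∷ ks@(suc _ ∷ _)) (_ ∷ pos)      =
  rle-∷-differs (expandRuns (- v) ks) (unit-≢-neg u) (rle-expandRuns (neg-unit u) ks pos)
rle-expandRuns {v} u  (suc (suc k) ∷ ks)  (_ ∷ pos)       =
  rle-∷-same v (expandRuns v (suc k ∷ ks)) (rle-expandRuns u (suc k ∷ ks) (s≤s z≤n ∷ pos))

runDecomposition : ∀ x xs → All IsUnit (x ∷ xs) →
                   ∃₂ λ k ks → All (1 ≤_) (k ∷ ks) × expandRuns x (k ∷ ks) ≡ x ∷ xs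
runDecomposition x []       _                      = 1 , [] , s≤s z≤n ∷ [] , refl
runDecomposition x (y ∷ ys) (ux ∷ uys@(uy ∷ _))
  with runDecomposition y ys uys | unit-dichotomy ux uy
... | k , ks , _ ∷ pos , eq | inj₁ refl = suc k , ks , s≤s z≤n ∷ pos , cong (x ∷_) eq
... | k , ks , pos     , eq | inj₂ refl = 1 , k ∷ ks , s≤s z≤n ∷ pos , cong (x ∷_) eq

length-expandRuns : ∀ v ks → length (expandRuns v ks) ≡ sum ks
length-expandRuns v []       = refl
length-expandRuns v (k ∷ ks) =
  trans (length-++ (replicate k v)) (cong₂ _+_ (length-replicate k) (length-expandRuns (- v) ks))

last-++-∷ : ∀ {A : Set} (xs : List A) y ys → last (xs ++ y ∷ ys) ≡ last (y ∷ ys)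
last-++-∷ []            y ys = refl
last-++-∷ (x ∷ [])      y ys = refl
last-++-∷ (x ∷ x′ ∷ xs) y ys = last-++-∷ (x′ ∷ xs) y ys

last-applyUpTo : ∀ {A : Set} (f : ℕ → A) n → last (applyUpTo f (suc n)) ≡ just (f n)
last-applyUpTo f n = trans (cong last (sym (applyUpTo-∷ʳ f n))) (last-++-∷ (applyUpTo f n) (f n) [])

last-expandRuns : ∀ {v} k ks → All (1 ≤_) (k ∷ ks) →
                  last (expandRuns v (k ∷ ks)) ≡ just (lastRunSign v ks)
last-expandRuns     1             []           _              = refl
last-expandRuns     (suc (suc k)) []           _              = last-expandRuns (suc k) [] (s≤s z≤n ∷ [])
last-expandRuns {v} k             (suc j ∷ js) (_ ∷ pj ∷ pos) =
  trans (last-++-∷ (replicate k v) (- v) _) (last-expandRuns (suc j) js (pj ∷ pos))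

sumAdjacentProducts : List ℤ → ℤ
sumAdjacentProducts []            = 0ℤ
sumAdjacentProducts (a ∷ [])      = 0ℤ
sumAdjacentProducts (a ∷ b ∷ xs) = b *ℤ a +ℤ sumAdjacentProducts (b ∷ xs)

-- Adjacent entries contribute +1 inside a run and -1 across a run boundary, so the sum is
-- (n - 1) - 2 (r - 1) for n entries in r runs.
sumAdjacentProducts-expandRuns : ∀ {v} k ks → IsUnit v → All (1 ≤_) (k ∷ ks) →
  sumAdjacentProducts (expandRuns v (k ∷ ks)) +ℤ + (2 * length (k ∷ ks)) ≡ + suc (k + sum ks)
sumAdjacentProducts-expandRuns 0 _  _ (() ∷ _)
sumAdjacentProducts-expandRuns 1 [] _ _ = refl
sumAdjacentProducts-expandRuns {v} 1 (j ∷ js) u (_ ∷ pos@(s≤s _ ∷ _)) = begin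
  (- v *ℤ v +ℤ A) +ℤ + (2 * suc (suc (length js)))
    ≡⟨ cong₂ (λ c m → (c +ℤ A) +ℤ + m) (neg-unit-* u) (*-suc 2 (suc (length js))) ⟩
  (-1ℤ +ℤ A) +ℤ (+ 2 +ℤ + (2 * suc (length js)))
    ≡⟨ shift A (+ (2 * suc (length js))) ⟩
  1ℤ +ℤ (A +ℤ + (2 * suc (length js)))
    ≡⟨ cong (1ℤ +ℤ_) (sumAdjacentProducts-expandRuns j js (neg-unit u) pos) ⟩
  + suc (1 + sum (j ∷ js)) ∎
  where
  A = sumAdjacentProducts (expandRuns (- v) (j ∷ js))
  shift : ∀ a b → (-1ℤ +ℤ a) +ℤ (+ 2 +ℤ b) ≡ 1ℤ +ℤ (a +ℤ b)
  shift = solve-∀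
sumAdjacentProducts-expandRuns {v} (suc (suc k)) ks u (_ ∷ pos) = begin
  (v *ℤ v +ℤ A) +ℤ + (2 * length (suc k ∷ ks))
    ≡⟨ cong (λ c → (c +ℤ A) +ℤ + (2 * length (suc k ∷ ks))) (unit-square u) ⟩
  (1ℤ +ℤ A) +ℤ + (2 * length (suc k ∷ ks))
    ≡⟨ +ℤ-assoc 1ℤ A _ ⟩
  1ℤ +ℤ (A +ℤ + (2 * length (suc k ∷ ks)))
    ≡⟨ cong (1ℤ +ℤ_) (sumAdjacentProducts-expandRuns (suc k) ks u (s≤s z≤n ∷ pos)) ⟩
  + suc (suc (suc k) + sum ks) ∎
  where
  A = sumAdjacentProducts (expandRuns v (suc k ∷ ks))

-- Closing the runs of a linear sequence into a cycle moves the first run behind the last one,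
-- merging the two when they have the same sign.
closeCycle : Bool → ℕ → List ℕ → List ℕ
closeCycle merge k []           = k ∷ []
closeCycle merge k (j ∷ [])     = if merge then k + j ∷ [] else j ∷ k ∷ []
closeCycle merge k (j ∷ i ∷ js) = j ∷ closeCycle merge k (i ∷ js)

cycGo-signedRuns : ∀ v w k j js →
  cycGo v k (signedRuns w (j ∷ js)) ≡ closeCycle ⌊ lastRunSign w js ≟ℤ v ⌋ k (j ∷ js)
cycGo-signedRuns v w k j []       = refl
cycGo-signedRuns v w k j (i ∷ js) = cong (j ∷_) (cycGo-signedRuns v (- w) k i js)

cycSizes-signedRuns : ∀ v k ks →
  cycSizes (signedRuns v (k ∷ ks)) ≡ closeCycle ⌊ lastRunSign v ks ≟ℤ v ⌋ k ks
cycSizes-signedRuns v k []       = refl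
cycSizes-signedRuns v k (j ∷ js) = cycGo-signedRuns v (- v) k j js

sum-closeCycle : ∀ merge k ks → sum (closeCycle merge k ks) ≡ k + sum ks
sum-closeCycle merge k []           = refl
sum-closeCycle true  k (j ∷ [])     = +-assoc k j 0
sum-closeCycle false k (j ∷ [])     = x∙yz≈y∙xz j k 0
sum-closeCycle merge k (j ∷ i ∷ js) =
  trans (cong (_+_ j) (sum-closeCycle merge k (i ∷ js))) (x∙yz≈y∙xz j k _)

All-closeCycle : ∀ merge k ks → All (1 ≤_) (k ∷ ks) → All (1 ≤_) (closeCycle merge k ks)
All-closeCycle merge k []           (pk ∷ [])        = pk ∷ []
All-closeCycle true  k (j ∷ [])     (pk ∷ _ ∷ [])    = ≤-trans pk (m≤m+n k j) ∷ []
All-closeCycle false k (j ∷ [])     (pk ∷ pj ∷ [])   = pj ∷ pk ∷ []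
All-closeCycle merge k (j ∷ i ∷ js) (pk ∷ pj ∷ pos) = pj ∷ All-closeCycle merge k (i ∷ js) (pk ∷ pos)

length-closeCycle-merge : ∀ k j js → length (closeCycle true k (j ∷ js)) ≡ length (j ∷ js)
length-closeCycle-merge k j []       = refl
length-closeCycle-merge k j (i ∷ js) = cong suc (length-closeCycle-merge k i js)

length-closeCycle-split : ∀ k js → length (closeCycle false k js) ≡ suc (length js)
length-closeCycle-split k []           = refl
length-closeCycle-split k (j ∷ [])     = refl
length-closeCycle-split k (j ∷ i ∷ js) = cong suc (length-closeCycle-split k (i ∷ js))

c+A≡0∧A+a≡b⇒a≡c+b : ∀ c A {a b} → c +ℤ A ≡ 0ℤ → A +ℤ a ≡ b → a ≡ c +ℤ b
c+A≡0∧A+a≡b⇒a≡c+b c A {a} {b} c+A≡0 A+a≡b = begin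
  a              ≡⟨ +ℤ-identityˡ a ⟨
  0ℤ +ℤ a        ≡⟨ cong (_+ℤ a) c+A≡0 ⟨
  (c +ℤ A) +ℤ a  ≡⟨ +ℤ-assoc c A a ⟩
  c +ℤ (A +ℤ a)  ≡⟨ cong (c +ℤ_) A+a≡b ⟩
  c +ℤ b         ∎

twice-length-closeCycle-merge : ∀ k ks → 1 ≤ k → 2 * suc (length ks) ≡ suc (suc (k + sum ks)) →
                                2 * length (closeCycle true k ks) ≡ k + sum ks
twice-length-closeCycle-merge (suc _) []       _ ()
twice-length-closeCycle-merge k       (j ∷ js) _ eq rewrite length-closeCycle-merge k j js =
  +-cancelˡ-≡ 2 _ _ (trans (sym (*-distribˡ-+ 2 1 (suc (length js)))) eq)

twice-length-closeCycle-split : ∀ k ks → 2 * suc (length ks) ≡ k + sum ks →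
                                2 * length (closeCycle false k ks) ≡ k + sum ks
twice-length-closeCycle-split k ks = trans (cong (2 *_) (length-closeCycle-split k ks))

-- The hypothesis is the vanishing cyclic autocorrelation at shift one, whose wrap-around
-- summand is x₀ xₙ₋₁.
twice-length-cycSizes : ∀ {v} k ks → IsUnit v → All (1 ≤_) (k ∷ ks) →
  v *ℤ lastRunSign v ks +ℤ sumAdjacentProducts (expandRuns v (k ∷ ks)) ≡ 0ℤ →
  2 * length (cycSizes (signedRuns v (k ∷ ks))) ≡ k + sum ks
twice-length-cycSizes {v} k ks u pos@(pk ∷ _) cyclic =
  subst (λ L → 2 * length L ≡ k + sum ks) (sym (cycSizes-signedRuns v k ks))
        (byFlag (lastRunSign v ks ≟ℤ v))
  where
  twice : + (2 * suc (length ks)) ≡ v *ℤ lastRunSign v ks +ℤ + suc (k + sum ks)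
  twice = c+A≡0∧A+a≡b⇒a≡c+b (v *ℤ lastRunSign v ks) (sumAdjacentProducts (expandRuns v (k ∷ ks))) cyclic
                   (sumAdjacentProducts-expandRuns k ks u pos)
  withWrap : ∀ {c} → v *ℤ lastRunSign v ks ≡ c → + (2 * suc (length ks)) ≡ c +ℤ + suc (k + sum ks)
  withWrap eq = trans twice (cong (_+ℤ + suc (k + sum ks)) eq)
  byFlag : (d : Dec (lastRunSign v ks ≡ v)) → 2 * length (closeCycle ⌊ d ⌋ k ks) ≡ k + sum ks
  byFlag (yes same)  = twice-length-closeCycle-merge k ks pk
                         (+-injective (withWrap (trans (cong (v *ℤ_) same) (unit-square u))))
  byFlag (no differ) with lastRunSign-± v ks
  ... | inj₁ same     = ⊥-elim (differ same)
  ... | inj₂ opposite = twice-length-closeCycle-split k ks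
                          (+-injective (withWrap (trans (cong (v *ℤ_) opposite) (unit-*-neg u))))

doublets : ℤ → ℕ → ℤ
doublets v 0             = v
doublets v 1             = v
doublets v (suc (suc t)) = - doublets v t

doublets-neg : ∀ v t → doublets (- v) t ≡ - doublets v t
doublets-neg v 0             = refl
doublets-neg v 1             = refl
doublets-neg v (suc (suc t)) = cong -_ (doublets-neg v t)

data DoubletRuns : List ℕ → Set where
  []  : DoubletRuns []
  [1] : DoubletRuns (1 ∷ [])
  2∷_ : ∀ {ks} → DoubletRuns ks → DoubletRuns (2 ∷ ks)

applyUpTo-cong : ∀ {A : Set} {f g : ℕ → A} → (∀ t → f t ≡ g t) → ∀ n → applyUpTo f n ≡ applyUpTo g n
applyUpTo-cong f≗g zero    = refl
applyUpTo-cong f≗g (suc n) = cong₂ _∷_ (f≗g 0) (applyUpTo-cong (f≗g ∘ suc) n)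

expandRuns-doublets : ∀ {v ks} → DoubletRuns ks → expandRuns v ks ≡ applyUpTo (doublets v) (sum ks)
expandRuns-doublets []                = refl
expandRuns-doublets [1]               = refl
expandRuns-doublets {v} {_ ∷ ks} (2∷ d) =
  cong (λ xs → v ∷ v ∷ xs) (trans (expandRuns-doublets d) (applyUpTo-cong (doublets-neg v) (sum ks)))

m+n≡2⇒m≡1×n≡1 : ∀ {m n} → 1 ≤ m → 1 ≤ n → m + n ≡ 2 → m ≡ 1 × n ≡ 1
m+n≡2⇒m≡1×n≡1 {1}                 {1}           _ _ refl = refl , refl
m+n≡2⇒m≡1×n≡1 {1}                 {suc (suc _)} _ _ ()
m+n≡2⇒m≡1×n≡1 {2}                 {suc _}       _ _ ()
m+n≡2⇒m≡1×n≡1 {suc (suc (suc _))} {suc _}       _ _ ()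

closeCycle-allTwo : ∀ merge k ks → All (1 ≤_) (k ∷ ks) → All (_≡ 2) (closeCycle merge k ks) →
                    DoubletRuns (k ∷ ks) ⊎ (k ≡ 1 × DoubletRuns ks)
closeCycle-allTwo merge k []           _               (refl ∷ [])        = inj₁ (2∷ [])
closeCycle-allTwo true  k (j ∷ [])     (pk ∷ pj ∷ [])  (k+j≡2 ∷ [])
  with m+n≡2⇒m≡1×n≡1 pk pj k+j≡2
... | refl , refl = inj₂ (refl , [1])
closeCycle-allTwo false k (j ∷ [])     _               (refl ∷ refl ∷ []) = inj₁ (2∷ 2∷ [])
closeCycle-allTwo merge k (j ∷ i ∷ js) (pk ∷ _ ∷ pos) (refl ∷ twos)
  with closeCycle-allTwo merge k (i ∷ js) (pk ∷ pos) twos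
... | inj₁ (2∷ d)     = inj₁ (2∷ 2∷ d)
... | inj₂ (refl , d) = inj₂ (refl , 2∷ d)

Antiperiodic : (ℕ → ℤ) → Set
Antiperiodic g = ∀ t → g (2 + t) ≡ - g t

allTwo⇒antiperiodic : ∀ v k ks → All (1 ≤_) (k ∷ ks) → All (_≡ 2) (cycSizes (signedRuns v (k ∷ ks))) →
  ∃ λ g → Antiperiodic g × expandRuns v (k ∷ ks) ≡ applyUpTo g (k + sum ks)
allTwo⇒antiperiodic v k ks pos twos
  with closeCycle-allTwo _ k ks pos (subst (All (_≡ 2)) (cycSizes-signedRuns v k ks) twos)
... | inj₁ d          = doublets v , (λ _ → refl) , expandRuns-doublets d
... | inj₂ (refl , d) = doublets v ∘ suc , (λ _ → refl) ,
  cong (v ∷_) (trans (expandRuns-doublets d) (applyUpTo-cong (doublets-neg v) (sum ks)))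

tabulate-toℕ : ∀ {A : Set} (f : ℕ → A) n → tabulate {n = n} (f ∘ toℕ) ≡ applyUpTo f n
tabulate-toℕ f zero    = refl
tabulate-toℕ f (suc n) = cong (f 0 ∷_) (tabulate-toℕ (f ∘ suc) n)

applyUpTo-injective : ∀ {A : Set} {f g : ℕ → A} n → applyUpTo f n ≡ applyUpTo g n →
                      ∀ {t} → t < n → f t ≡ g t
applyUpTo-injective (suc n) eq {zero}  _         = proj₁ (∷-injective eq)
applyUpTo-injective (suc n) eq {suc t} (s≤s t<n) = applyUpTo-injective n (proj₂ (∷-injective eq)) t<n

sumAdjacentProducts-applyUpTo : ∀ (f : ℕ → ℤ) n →
  sumAdjacentProducts (applyUpTo f (suc n)) ≡ sumℤ (applyUpTo (λ t → f (suc t) *ℤ f t) n)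
sumAdjacentProducts-applyUpTo f zero    = refl
sumAdjacentProducts-applyUpTo f (suc n) =
  cong (f 1 *ℤ f 0 +ℤ_) (sumAdjacentProducts-applyUpTo (f ∘ suc) n)

sumℤ-minusOnes : ∀ n → sumℤ (applyUpTo (λ _ → -1ℤ) (suc n)) ≡ -[1+ n ]
sumℤ-minusOnes zero    = refl
sumℤ-minusOnes (suc n) = cong (-1ℤ +ℤ_) (sumℤ-minusOnes n)

periodic-multiple : ∀ {A : Set} {g : ℕ → A} {p} → (∀ t → g (p + t) ≡ g t) → ∀ q t → g (q * p + t) ≡ g t
periodic-multiple         per zero    t = refl
periodic-multiple {g = g} {p} per (suc q) t =
  trans (cong g (+-assoc p (q * p) t)) (trans (per (q * p + t)) (periodic-multiple per q t))

periodic-% : ∀ {A : Set} {g : ℕ → A} n .{{_ : NonZero n}} → (∀ t → g (n + t) ≡ g t) →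
             ∀ t → g (t % n) ≡ g t
periodic-% {g = g} n per t = sym (begin
  g t                  ≡⟨ cong g (m≡m%n+[m/n]*n t n) ⟩
  g (t % n + t / n * n) ≡⟨ cong g (+-comm (t % n) (t / n * n)) ⟩
  g (t / n * n + t % n) ≡⟨ periodic-multiple per (t / n) (t % n) ⟩
  g (t % n)            ∎)

antiperiodic-period4 : ∀ {g} → Antiperiodic g → ∀ t → g (4 + t) ≡ g t
antiperiodic-period4 {g} anti t = trans (anti (2 + t)) (trans (cong -_ (anti t)) (neg-involutive (g t)))

antiperiodic-period : ∀ {g n} → Antiperiodic g → 4 ∣ n → ∀ t → g (n + t) ≡ g t
antiperiodic-period anti (divides d refl) = periodic-multiple (antiperiodic-period4 anti) d

module DefiningRow (N : ℕ) (h : Fin (suc N) → ℤ) where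

  n : ℕ
  n = suc N

  x : ℕ → ℤ
  x t = h (t mod n)

  x-cong-% : ∀ {a b} → a % n ≡ b % n → x a ≡ x b
  x-cong-% {a} {b} eq = cong h (fromℕ<-cong _ _ eq (m%n<n a n) (m%n<n b n))

  x-periodic : ∀ t → x (n + t) ≡ x t
  x-periodic t = x-cong-% {n + t} {t} (trans (cong (_% n) (+-comm n t)) ([m+n]%n≡m%n t n))

  x-toℕ : ∀ i → x (toℕ i) ≡ h i
  x-toℕ i = cong h (trans (fromℕ<-cong _ _ (m<n⇒m%n≡m (toℕ<n i)) _ (toℕ<n i)) (fromℕ<-toℕ i (toℕ<n i)))

  tabulate-h : tabulate h ≡ applyUpTo x n
  tabulate-h = trans (tabulate-cong (sym ∘ x-toℕ)) (tabulate-toℕ x n)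

  -- circ h i k is definitionally x (n + toℕ k ∸ toℕ i); the offset n keeps ∸ from truncating.
  autocorrelation : ℕ → ℤ
  autocorrelation s = sumℤ (applyUpTo (λ t → x (n + t) *ℤ x (n + t ∸ s)) n)

  rowDot-circ : ∀ i → rowDot (circ h) zero i ≡ autocorrelation (toℕ i)
  rowDot-circ i = trans (cong sumℤ (map-tabulate id (λ k → circ h zero k *ℤ circ h i k)))
                        (cong sumℤ (tabulate-toℕ (λ t → x (n + t) *ℤ x (n + t ∸ toℕ i)) n))

  autocorrelation-1 : autocorrelation 1 ≡ x 0 *ℤ x N +ℤ sumAdjacentProducts (applyUpTo x n)
  autocorrelation-1 =
    cong₂ _+ℤ_ (cong₂ _*ℤ_ (x-periodic 0) (cong x (+-identityʳ N)))
               (trans (cong sumℤ (applyUpTo-cong term N)) (sym (sumAdjacentProducts-applyUpTo x N)))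
    where
    term : ∀ t → x (n + suc t) *ℤ x (N + suc t) ≡ x (suc t) *ℤ x t
    term t = cong₂ _*ℤ_ (x-periodic (suc t)) (trans (cong x (+-suc N t)) (x-periodic t))

  autocorrelation-2 : 2 ≤ n → (∀ t → IsUnit (x t)) → Antiperiodic x → autocorrelation 2 ≡ -[1+ N ]
  autocorrelation-2 2≤n unit anti = trans (cong sumℤ (applyUpTo-cong term n)) (sumℤ-minusOnes N)
    where
    term : ∀ t → x (n + t) *ℤ x (n + t ∸ 2) ≡ -1ℤ
    term t = trans (cong (_*ℤ x (n + t ∸ 2)) (trans (cong x (sym (m+[n∸m]≡n (≤-trans 2≤n (m≤m+n n t)))))
                                                    (anti (n + t ∸ 2))))
                   (neg-unit-* (unit (n + t ∸ 2)))

  module _ (hadamard : IsHadamard (circ h)) (4∣n : 4 ∣ n) where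

    x-unit : ∀ t → IsUnit (x t)
    x-unit t = subst IsUnit (trans (x-periodic _) (x-toℕ (t mod n))) (proj₁ hadamard zero (t mod n))

    2<n : 2 < n
    2<n = ≤-trans (s≤s (s≤s (s≤s z≤n))) (∣⇒≤ 4∣n)

    autocorrelation-vanishes : ∀ {s} → 0 < s → s < n → autocorrelation s ≡ 0ℤ
    autocorrelation-vanishes {s} 0<s s<n =
      subst (λ r → autocorrelation r ≡ 0ℤ) (toℕ-fromℕ< s<n)
            (trans (sym (rowDot-circ (fromℕ< s<n))) (proj₂ hadamard zero (fromℕ< s<n) zero≢))
      where
      zero≢ : zero ≢ fromℕ< s<n
      zero≢ eq = <⇒≢ 0<s (trans (cong toℕ eq) (toℕ-fromℕ< s<n))

    not-antiperiodic : ¬ Antiperiodic x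
    not-antiperiodic anti = absurd (trans (sym (autocorrelation-2 (<⇒≤ 2<n) x-unit anti))
                                          (autocorrelation-vanishes (s≤s z≤n) 2<n))
      where
      absurd : -[1+ N ] ≢ 0ℤ
      absurd ()

    module Blocks {k ks} (pos : All (1 ≤_) (k ∷ ks))
                  (expand≡ : expandRuns (x 0) (k ∷ ks) ≡ applyUpTo x n) where

      L : List ℕ
      L = cycSizes (signedRuns (x 0) (k ∷ ks))

      blockSizes≡ : blockSizes h ≡ L
      blockSizes≡ = trans (cong (cycSizes ∘ rle) (trans tabulate-h (sym expand≡)))
                          (cong cycSizes (rle-expandRuns (x-unit 0) (k ∷ ks) pos))

      positive : All (1 ≤_) L
      positive = subst (All (1 ≤_)) (sym (cycSizes-signedRuns (x 0) k ks)) (All-closeCycle _ k ks pos)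

      size≡n : k + sum ks ≡ n
      size≡n = trans (sym (length-expandRuns (x 0) (k ∷ ks)))
                     (trans (cong length expand≡) (length-applyUpTo x n))

      lastSign≡ : x N ≡ lastRunSign (x 0) ks
      lastSign≡ = just-injective (trans (sym (last-applyUpTo x N))
                                        (trans (cong last (sym expand≡)) (last-expandRuns k ks pos)))

      twice-length : 2 * length L ≡ n
      twice-length = trans (twice-length-cycSizes k ks (x-unit 0) pos cyclic) size≡n
        where
        cyclic : x 0 *ℤ lastRunSign (x 0) ks +ℤ sumAdjacentProducts (expandRuns (x 0) (k ∷ ks)) ≡ 0ℤ
        cyclic = trans (cong₂ (λ c xs → x 0 *ℤ c +ℤ sumAdjacentProducts xs) (sym lastSign≡) expand≡)
                       (trans (sym autocorrelation-1) (autocorrelation-vanishes (s≤s z≤n) (<⇒≤ 2<n)))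

      mean-two : sum L ≡ 2 * length L
      mean-two = trans (cong sum (cycSizes-signedRuns (x 0) k ks))
                       (trans (sum-closeCycle _ k ks) (trans size≡n (sym twice-length)))

      0<length : 0 < length L
      0<length with length L | twice-length
      ... | suc _ | _ = s≤s z≤n

      ¬allTwo : ¬ All (_≡ 2) L
      ¬allTwo twos with allTwo⇒antiperiodic (x 0) k ks pos twos
      ... | g , anti , expand≡g = not-antiperiodic x-anti
        where
        x≡g-below : ∀ {t} → t < n → x t ≡ g t
        x≡g-below = applyUpTo-injective {f = x} {g} n
                      (trans (sym expand≡) (trans expand≡g (cong (applyUpTo g) size≡n)))
        x≡g : ∀ t → x t ≡ g t
        x≡g t = trans (sym (x-cong-% {t % n} {t} (m%n%n≡m%n t n)))
                      (trans (x≡g-below (m%n<n t n)) (periodic-% n (antiperiodic-period anti 4∣n) t))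
        x-anti : Antiperiodic x
        x-anti t = trans (x≡g (2 + t)) (trans (anti t) (cong -_ (sym (x≡g t))))

    circulantHadamard-runIdentity : alpha 1 h + alpha2GE3 h ≡ alpha 2 h + alphaGE 3 h
    circulantHadamard-runIdentity
      with runDecomposition (x 0) (applyUpTo (x ∘ suc) N) (applyUpTo⁺₂ x n x-unit)
    ... | k , ks , pos , expand≡ =
      subst (λ L → numRuns isOne L + count twoNextToThree (consecPairs L)
                 ≡ numRuns isTwo L + numRuns atLeastThree L)
            (sym blockSizes≡)
            (runIdentity L positive (meanTwo⇒¬All≡1 0<length mean-two) ¬allTwo
                         (meanTwo⇒¬All≥3 0<length mean-two))
      where open Blocks pos expand≡

lemma4 : (m : ℕ) → 1 < 4 * m → (h : Fin (4 * m) → ℤ) →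
    IsHadamard (circ h) →
    alpha 1 h + alpha2GE3 h ≡ alpha 2 h + alphaGE 3 h
lemma4 zero    () h hadamard
lemma4 (suc m) _  h hadamard =
  -- 4 * suc m computes to suc (m + 3 * suc m), the length DefiningRow expects.
  DefiningRow.circulantHadamard-runIdentity (m + 3 * suc m) h hadamard (m∣m*n (suc m))
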